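{- For every integer $n\geq 9$ with $n\neq 14$, $\lambda_1^1(P_4 \times C_n)=4$.
   Context: For a graph $G$, an $L(1,1)$-labeling with labels in $\{0,1,\dots,p\}$ is a function $l:V(G)\to\{0,1,\dots,p\}$ such that $l(u)\neq l(v)$ whenever the distance $d(u,v)$ is $1$ or $2$. $\lambda_1^1(G)$ denotes the least $p$ for which $G$ admits such a labeling. $P_m$ denotes the path with $m$ vertices and $C_n$ the cycle with $n$ vertices. The direct product $G\times H$ has vertex set $V(G)\times V(H)$, with $(x_1,x_2)$ adjacent to $(y_1,y_2)$ iff $x_1y_1\in E(G)$ and $x_2y_2\in E(H)$. -}

module Defs where

open import Data.Nat using (ℕ; suc; _≤_)
open import Data.Fin using (Fin; toℕ)
open import Data.Product using (_×_; _,_; ∃)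
open import Data.Sum using (_⊎_)
open import Relation.Binary.PropositionalEquality using (_≡_; _≢_)

record Graph : Set₁ where
  field
    V   : Set
    Adj : V → V → Set
open Graph public

Path : ℕ → Graph
Path m = record { V = Fin m
                ; Adj = λ i j → (toℕ j ≡ suc (toℕ i)) ⊎ (toℕ i ≡ suc (toℕ j)) }

-- Cycle C_n on vertices 0,…,n-1 (n ≥ 3) : i ~ j iff j ≡ i+1 or i ≡ j+1 (mod n).
-- "Succ n i j" means j is the cyclic successor of i.
Succ : (n : ℕ) → Fin n → Fin n → Set
Succ n i j = (toℕ j ≡ suc (toℕ i)) ⊎ (suc (toℕ i) ≡ n × toℕ j ≡ 0)

Cycle : ℕ → Graph
Cycle n = record { V = Fin n ; Adj = λ i j → Succ n i j ⊎ Succ n j i }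

_⊗_ : Graph → Graph → Graph
G ⊗ H = record { V = V G × V H
               ; Adj = λ { (x₁ , x₂) (y₁ , y₂) → Adj G x₁ y₁ × Adj H x₂ y₂ } }

Dist12 : (G : Graph) → V G → V G → Set
Dist12 G u v = Adj G u v ⊎ (u ≢ v × ∃ λ w → Adj G u w × Adj G w v)

IsL11Labeling : (G : Graph) (p : ℕ) → (V G → Fin (suc p)) → Set
IsL11Labeling G p l = ∀ u v → Dist12 G u v → l u ≢ l v

HasL11Labeling : Graph → ℕ → Set
HasL11Labeling G p = ∃ λ (l : V G → Fin (suc p)) → IsL11Labeling G p l

λ11≡ : Graph → ℕ → Set
λ11≡ G p = HasL11Labeling G p × (∀ q → HasL11Labeling G q → p ≤ q)

-- The vertex (1 , 0) of P₄ × Cₙ has four neighbours, and any two vertices of its closed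
-- neighbourhood are at distance 1 or 2, so five labels are needed.
-- Conversely, a labeling is L(1,1) as soon as it is injective on every closed neighbourhood,
-- and in P₄ × Cₙ the closed neighbourhood of a vertex lies in three consecutive columns.
-- A labeling is therefore a cyclic word of n columns whose windows of three consecutive
-- columns are all good, which is decided by evaluation. Explicit words cover n = 9, …, 13
-- and 15, …, 19; the words of lengths 10 to 13 all end in the same two columns, so they
-- concatenate, which gives 10 + n from n, and 24 = 12 + 12.

module Submission where

open import Defs
open import Data.Nat using (ℕ; zero; suc; _+_; _<_; _≤_; z≤n; s≤s; s≤s⁻¹; _≤?_)
open import Data.Nat.Properties using (suc-injective; 0≢1+n; 1+n≢n; <-irrefl; <⇒≢; ≤∧≢⇒<; ≰⇒>; m≤n⇒∃[o]m+o≡n)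
import Data.Fin as Fin
import Data.Nat.Properties as ℕ
open import Data.Fin using (Fin; zero; suc; toℕ; #_; fromℕ; inject₁; fromℕ<)
open import Data.Fin.Properties using (all?; toℕ-injective; toℕ-fromℕ; toℕ-inject₁; toℕ-fromℕ<; toℕ<n; pigeonhole) renaming (_≟_ to _≟ᶠ_)
open import Data.Vec using (Vec; []; _∷_; lookup; replicate)
import Data.Vec.Properties as Vec
import Data.Vec.Functional as Vector
open import Data.List using (List; []; _∷_; _++_; length)
open import Data.List.Properties using (length-++)
open import Data.Product using (_×_; _,_; ∃; ∃₂)
import Data.Product.Properties as Product
open import Data.Sum using (_⊎_; inj₁; inj₂; swap)
open import Data.Empty using (⊥; ⊥-elim)
open import Data.Unit using (⊤; tt)
open import Function using (_∘_)
open import Function.Definitions using (Injective)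
open import Relation.Binary.Definitions using (Symmetric; Irreflexive)
open import Relation.Nullary using (Dec; yes; no)
open import Relation.Nullary.Decidable using (True; toWitness; _×-dec_; _⊎-dec_; _→-dec_; ¬?; from-yes)
open import Relation.Binary.PropositionalEquality using (_≡_; _≢_; refl; sym; trans; cong; subst)

InClosedNbhd : (G : Graph) → V G → V G → Set
InClosedNbhd G w x = w ≡ x ⊎ Adj G w x

InjectiveOnClosedNbhds : (G : Graph) {A : Set} → (V G → A) → Set
InjectiveOnClosedNbhds G l = ∀ w {x y} → InClosedNbhd G w x → InClosedNbhd G w y → x ≢ y → l x ≢ l y

module _ {G : Graph} where

  injectiveOnClosedNbhds⇒L11 : Symmetric (Adj G) → Irreflexive _≡_ (Adj G) →
    ∀ {p} {l : V G → Fin (suc p)} → InjectiveOnClosedNbhds G l → IsL11Labeling G p l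
  injectiveOnClosedNbhds⇒L11 _ irr inj u v (inj₁ uv) = inj u (inj₁ refl) (inj₂ uv) (λ u≡v → irr u≡v uv)
  injectiveOnClosedNbhds⇒L11 symmetric _ inj u v (inj₂ (u≢v , w , uw , wv)) =
    inj w (inj₂ (symmetric uw)) (inj₂ wv) u≢v

  Dist12-clique⇒L11-bound : ∀ {m q} (g : Fin m → V G) → (∀ {i j} → i Fin.< j → Dist12 G (g i) (g j)) →
    HasL11Labeling G q → m ≤ suc q
  Dist12-clique⇒L11-bound {m} {q} g clique (l , isL) with m ≤? suc q
  ... | yes m≤1+q = m≤1+q
  ... | no m≰1+q with pigeonhole (≰⇒> m≰1+q) (l ∘ g)
  ... | i , j , i<j , same = ⊥-elim (isL (g i) (g j) (clique i<j) same)

  star-Dist12 : Symmetric (Adj G) → ∀ {d v} {nbr : Fin d → V G} → (∀ i → Adj G v (nbr i)) →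
    Injective _≡_ _≡_ nbr → ∀ {i j} → i Fin.< j → Dist12 G ((v Vector.∷ nbr) i) ((v Vector.∷ nbr) j)
  star-Dist12 _ adj _ {zero} {suc j} _ = inj₁ (adj j)
  star-Dist12 symmetric {v = v} adj inj {suc i} {suc j} (s≤s i<j) =
    inj₂ ((λ e → <⇒≢ i<j (cong toℕ (inj e))) , v , symmetric (adj i) , adj j)

  degree⇒L11-bound : Symmetric (Adj G) → ∀ {d q v} (nbr : Fin d → V G) → (∀ i → Adj G v (nbr i)) →
    Injective _≡_ _≡_ nbr → HasL11Labeling G q → d ≤ q
  degree⇒L11-bound symmetric nbr adj inj labeling =
    s≤s⁻¹ (Dist12-clique⇒L11-bound _ (star-Dist12 symmetric adj inj) labeling)

Path-irreflexive : ∀ {m} → Irreflexive _≡_ (Adj (Path m))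
Path-irreflexive refl (inj₁ e) = 1+n≢n (sym e)
Path-irreflexive refl (inj₂ e) = 1+n≢n (sym e)

⊗-symmetric : ∀ {G H} → Symmetric (Adj G) → Symmetric (Adj H) → Symmetric (Adj (G ⊗ H))
⊗-symmetric symG symH (p , q) = symG p , symH q

⊗-irreflexiveˡ : ∀ {G H} → Irreflexive _≡_ (Adj G) → Irreflexive _≡_ (Adj (G ⊗ H))
⊗-irreflexiveˡ irr refl (p , _) = irr refl p

P₄×C-symmetric : ∀ {n} → Symmetric (Adj (Path 4 ⊗ Cycle n))
P₄×C-symmetric = ⊗-symmetric {Path 4} {Cycle _} swap swap

predecessor : ∀ {n} (m : Fin n) → ∃ λ a → Succ n a m
predecessor {suc n} zero = fromℕ n , inj₂ (cong suc (toℕ-fromℕ n) , refl)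
predecessor {suc n} (suc m) = inject₁ m , inj₁ (cong suc (sym (toℕ-inject₁ m)))

successor : ∀ {n} (m : Fin n) → ∃ λ c → Succ n m c
successor {suc n} m with suc (toℕ m) ℕ.≟ suc n
... | yes last = zero , inj₂ (last , refl)
... | no notLast = fromℕ< m+1<n , inj₁ (toℕ-fromℕ< m+1<n)
  where
  m+1<n : suc (toℕ m) < suc n
  m+1<n = ≤∧≢⇒< (toℕ<n m) notLast

module _ {n : ℕ} where

  Succ-injective : ∀ {a a' m} → Succ n a m → Succ n a' m → a ≡ a'
  Succ-injective (inj₁ p) (inj₁ q) = toℕ-injective (suc-injective (trans (sym p) q))
  Succ-injective (inj₁ p) (inj₂ (_ , q)) = ⊥-elim (0≢1+n (trans (sym q) p))
  Succ-injective (inj₂ (_ , q)) (inj₁ p) = ⊥-elim (0≢1+n (trans (sym q) p))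
  Succ-injective (inj₂ (p , _)) (inj₂ (q , _)) = toℕ-injective (suc-injective (trans p (sym q)))

  Succ-functional : ∀ {m c c'} → Succ n m c → Succ n m c' → c ≡ c'
  Succ-functional (inj₁ p) (inj₁ q) = toℕ-injective (trans p (sym q))
  Succ-functional {c = c} (inj₁ p) (inj₂ (last , _)) = ⊥-elim (<-irrefl refl (subst (_< n) (trans p last) (toℕ<n c)))
  Succ-functional {c' = c'} (inj₂ (last , _)) (inj₁ q) = ⊥-elim (<-irrefl refl (subst (_< n) (trans q last) (toℕ<n c')))
  Succ-functional (inj₂ (_ , p)) (inj₂ (_ , q)) = toℕ-injective (trans p (sym q))

Path-adjacent? : ∀ {m} (i j : Fin m) → Dec (Adj (Path m) i j)
Path-adjacent? i j = (toℕ j ℕ.≟ suc (toℕ i)) ⊎-dec (toℕ i ℕ.≟ suc (toℕ j))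

Column : Set
Column = Vec (Fin 5) 4

pick : {A : Set} → A → A → A → Fin 3 → A
pick a b c zero = a
pick a b c (suc zero) = b
pick a b c (suc (suc zero)) = c

pick-map : {A B : Set} (f : A → B) {a b c : A} (s : Fin 3) → f (pick a b c s) ≡ pick (f a) (f b) (f c) s
pick-map f zero = refl
pick-map f (suc zero) = refl
pick-map f (suc (suc zero)) = refl

-- Cell (r , s) of three consecutive columns lies in the closed neighbourhood of cell (k , 1) in P₄ × Cₙ.
WindowNbhd : Fin 4 → Fin 3 → Fin 4 → Set
WindowNbhd k zero r = Adj (Path 4) k r
WindowNbhd k (suc zero) r = k ≡ r
WindowNbhd k (suc (suc zero)) r = Adj (Path 4) k r

WindowNbhd? : ∀ k s r → Dec (WindowNbhd k s r)
WindowNbhd? k zero r = Path-adjacent? k r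
WindowNbhd? k (suc zero) r = k ≟ᶠ r
WindowNbhd? k (suc (suc zero)) r = Path-adjacent? k r

GoodWindow : Column → Column → Column → Set
GoodWindow a b c = ∀ k s r s' r' → WindowNbhd k s r → WindowNbhd k s' r' → (s , r) ≢ (s' , r') →
  lookup (pick a b c s) r ≢ lookup (pick a b c s') r'

GoodWindow? : ∀ a b c → Dec (GoodWindow a b c)
GoodWindow? a b c = all? λ k → all? λ s → all? λ r → all? λ s' → all? λ r' →
  WindowNbhd? k s r →-dec WindowNbhd? k s' r' →-dec
  ¬? (Product.≡-dec _≟ᶠ_ _≟ᶠ_ (s , r) (s' , r')) →-dec
  ¬? (lookup (pick a b c s) r ≟ᶠ lookup (pick a b c s') r')

GoodWindow-cong : ∀ {a a' b b' c c'} → a ≡ a' → b ≡ b' → c ≡ c' → GoodWindow a b c → GoodWindow a' b' c'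
GoodWindow-cong refl refl refl good = good

AllWindows : List Column → Set
AllWindows (a ∷ b ∷ c ∷ cs) = GoodWindow a b c × AllWindows (b ∷ c ∷ cs)
AllWindows _ = ⊤

AllWindows? : ∀ w → Dec (AllWindows w)
AllWindows? (a ∷ b ∷ c ∷ cs) = GoodWindow? a b c ×-dec AllWindows? (b ∷ c ∷ cs)
AllWindows? [] = yes tt
AllWindows? (_ ∷ []) = yes tt
AllWindows? (_ ∷ _ ∷ []) = yes tt

EndsWith : List Column → Column → Column → Set
EndsWith (a ∷ b ∷ []) e₁ e₂ = a ≡ e₁ × b ≡ e₂
EndsWith (_ ∷ b ∷ c ∷ cs) e₁ e₂ = EndsWith (b ∷ c ∷ cs) e₁ e₂
EndsWith _ _ _ = ⊥

EndsWith? : ∀ w e₁ e₂ → Dec (EndsWith w e₁ e₂)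
EndsWith? (a ∷ b ∷ []) e₁ e₂ = Vec.≡-dec _≟ᶠ_ a e₁ ×-dec Vec.≡-dec _≟ᶠ_ b e₂
EndsWith? (_ ∷ b ∷ c ∷ cs) e₁ e₂ = EndsWith? (b ∷ c ∷ cs) e₁ e₂
EndsWith? [] _ _ = no λ ()
EndsWith? (_ ∷ []) _ _ = no λ ()

-- The word w, read cyclically, has only good windows; e₁ e₂ are its last two columns.
GoodCycle : Column → Column → List Column → Set
GoodCycle e₁ e₂ w = AllWindows (e₁ ∷ e₂ ∷ w) × EndsWith w e₁ e₂

goodCycle? : ∀ e₁ e₂ w → Dec (GoodCycle e₁ e₂ w)
goodCycle? e₁ e₂ w = AllWindows? (e₁ ∷ e₂ ∷ w) ×-dec EndsWith? w e₁ e₂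

EndsWith-∷ : ∀ {e₁ e₂} a w → EndsWith w e₁ e₂ → EndsWith (a ∷ w) e₁ e₂
EndsWith-∷ a (_ ∷ _ ∷ _) ends = ends

EndsWith-++ : ∀ {e₁ e₂} u w → EndsWith w e₁ e₂ → EndsWith (u ++ w) e₁ e₂
EndsWith-++ [] w ends = ends
EndsWith-++ (a ∷ u) w ends = EndsWith-∷ a (u ++ w) (EndsWith-++ u w ends)

AllWindows-++ : ∀ {e₁ e₂} a b u w → AllWindows (a ∷ b ∷ u) → EndsWith (a ∷ b ∷ u) e₁ e₂ →
  AllWindows (e₁ ∷ e₂ ∷ w) → AllWindows (a ∷ b ∷ u ++ w)
AllWindows-++ a b [] w _ (refl , refl) windows = windows
AllWindows-++ a b (c ∷ u) w (good , windowsᵤ) ends windows = good , AllWindows-++ b c u w windowsᵤ ends windows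

GoodCycle-++ : ∀ {e₁ e₂} u w → GoodCycle e₁ e₂ u → GoodCycle e₁ e₂ w → GoodCycle e₁ e₂ (u ++ w)
GoodCycle-++ {e₁} {e₂} u w (windowsᵤ , endsᵤ) (windows , ends) =
  AllWindows-++ e₁ e₂ u w windowsᵤ (EndsWith-∷ e₁ (e₂ ∷ u) (EndsWith-∷ e₂ u endsᵤ)) windows ,
  EndsWith-++ u w ends

at : List Column → ℕ → Column
at [] _ = replicate 4 zero
at (a ∷ _) zero = a
at (_ ∷ w) (suc i) = at w i

AllWindows-at : ∀ w t → 2 + t < length w → AllWindows w → GoodWindow (at w t) (at w (1 + t)) (at w (2 + t))
AllWindows-at (a ∷ b ∷ c ∷ cs) zero _ (good , _) = good
AllWindows-at (a ∷ b ∷ c ∷ cs) (suc t) (s≤s bound) (_ , windows) = AllWindows-at (b ∷ c ∷ cs) t bound windows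
AllWindows-at (_ ∷ []) t (s≤s ()) _
AllWindows-at (_ ∷ _ ∷ []) t (s≤s (s≤s ())) _

EndsWith-last : ∀ {e₁ e₂ i} w → EndsWith w e₁ e₂ → suc i ≡ length w → at w i ≡ e₂
EndsWith-last (a ∷ b ∷ []) (_ , b≡e₂) refl = b≡e₂
EndsWith-last (a ∷ b ∷ c ∷ cs) ends refl = EndsWith-last (b ∷ c ∷ cs) ends refl

EndsWith-penultimate : ∀ {e₁ e₂ i} w → EndsWith w e₁ e₂ → 2 + i ≡ length w → at w i ≡ e₁
EndsWith-penultimate (a ∷ b ∷ []) (a≡e₁ , _) refl = a≡e₁
EndsWith-penultimate (a ∷ b ∷ c ∷ cs) ends refl = EndsWith-penultimate (b ∷ c ∷ cs) ends refl

CyclicallyGood : ∀ {n} → (Fin n → Column) → Set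
CyclicallyGood {n} col = ∀ {a m c} → Succ n a m → Succ n m c → GoodWindow (col a) (col m) (col c)

goodCycle⇒cyclicallyGood : ∀ {n e₁ e₂} w → length w ≡ n → 3 ≤ n → GoodCycle e₁ e₂ w →
  CyclicallyGood (λ (j : Fin n) → at w (toℕ j))
-- The cyclic window (a , m , c) of w is the window of e₁ e₂ w at position 2 + a,
-- or at position 1 if it wraps around at m = 0, or at position 0 if it wraps around at c = 0.
goodCycle⇒cyclicallyGood {e₁ = e₁} {e₂} w refl 3≤n (windows , ends) = cyclic
  where
  window : ∀ t → t < length w → GoodWindow (at (e₁ ∷ e₂ ∷ w) t) (at (e₁ ∷ e₂ ∷ w) (1 + t)) (at w t)
  window t t<n = AllWindows-at (e₁ ∷ e₂ ∷ w) t (s≤s (s≤s t<n)) windows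

  cyclic : CyclicallyGood (λ (j : Fin (length w)) → at w (toℕ j))
  cyclic {a} {m} {c} (inj₁ m≡1+a) (inj₁ c≡1+m) =
    GoodWindow-cong refl (cong (at w) (sym m≡1+a)) (cong (at w) (sym c≡2+a))
      (window (2 + toℕ a) (subst (_< length w) c≡2+a (toℕ<n c)))
    where
    c≡2+a : toℕ c ≡ 2 + toℕ a
    c≡2+a = trans c≡1+m (cong suc m≡1+a)
  cyclic {a} {m} {c} (inj₂ (1+a≡n , m≡0)) (inj₁ c≡1+m) =
    GoodWindow-cong (sym (EndsWith-last w ends 1+a≡n))
      (cong (at w) (sym m≡0)) (cong (at w) (sym (trans c≡1+m (cong suc m≡0))))
      (window 1 (ℕ.≤-trans (s≤s (s≤s z≤n)) 3≤n))
  cyclic {a} {m} {c} (inj₁ m≡1+a) (inj₂ (1+m≡n , c≡0)) =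
    GoodWindow-cong (sym (EndsWith-penultimate w ends (trans (cong suc (sym m≡1+a)) 1+m≡n)))
      (sym (EndsWith-last w ends 1+m≡n)) (cong (at w) (sym c≡0))
      (window 0 (ℕ.≤-trans (s≤s z≤n) 3≤n))
  cyclic (inj₂ (_ , m≡0)) (inj₂ (1+m≡n , _))
    with s≤s () ← subst (3 ≤_) (trans (sym 1+m≡n) (cong suc m≡0)) 3≤n

columnLabeling : ∀ {n} → (Fin n → Column) → V (Path 4 ⊗ Cycle n) → Fin 5
columnLabeling col (r , j) = lookup (col j) r

windowPosition : ∀ {n k x} {a m c : Fin n} → Succ n a m → Succ n m c →
  InClosedNbhd (Path 4 ⊗ Cycle n) (k , m) x → ∃₂ λ s r → WindowNbhd k s r × x ≡ (r , pick a m c s)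
windowPosition _ _ (inj₁ refl) = suc zero , _ , refl , refl
windowPosition {x = r , j} a→m _ (inj₂ (k~r , inj₂ j→m)) =
  zero , r , k~r , cong (r ,_) (Succ-injective j→m a→m)
windowPosition {x = r , j} _ m→c (inj₂ (k~r , inj₁ m→j)) =
  suc (suc zero) , r , k~r , cong (r ,_) (Succ-functional m→j m→c)

cyclicallyGood⇒injectiveOnClosedNbhds : ∀ {n} {col : Fin n → Column} → CyclicallyGood col →
  InjectiveOnClosedNbhds (Path 4 ⊗ Cycle n) (columnLabeling col)
cyclicallyGood⇒injectiveOnClosedNbhds {col = col} good (k , m) x∈ y∈ x≢y
  with a , a→m ← predecessor m | c , m→c ← successor m
  with s , r , sr∈ , refl ← windowPosition a→m m→c x∈
     | s' , r' , s'r'∈ , refl ← windowPosition a→m m→c y∈ =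
  λ same → good a→m m→c k s r s' r' sr∈ s'r'∈ (x≢y ∘ cong λ (s , r) → r , pick a m c s)
    (trans (sym (label-pick s r)) (trans same (label-pick s' r')))
  where
  label-pick : ∀ s r → columnLabeling col (r , pick a m c s) ≡ lookup (pick (col a) (col m) (col c) s) r
  label-pick s r = cong (λ column → lookup column r) (pick-map col s)

cyclicallyGood⇒L11 : ∀ {n} {col : Fin n → Column} → CyclicallyGood col →
  IsL11Labeling (Path 4 ⊗ Cycle n) 4 (columnLabeling col)
cyclicallyGood⇒L11 good = injectiveOnClosedNbhds⇒L11 P₄×C-symmetric
  (⊗-irreflexiveˡ {Path 4} {Cycle _} Path-irreflexive) (cyclicallyGood⇒injectiveOnClosedNbhds good)

module _ (k : ℕ) where

  private
    last : Fin (3 + k)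
    last = fromℕ (2 + k)

    last→0 : Succ (3 + k) last zero
    last→0 = inj₂ (cong suc (toℕ-fromℕ (2 + k)) , refl)

  neighbours : Fin 4 → V (Path 4 ⊗ Cycle (3 + k))
  neighbours zero = # 0 , last
  neighbours (suc zero) = # 0 , # 1
  neighbours (suc (suc zero)) = # 2 , last
  neighbours (suc (suc (suc zero))) = # 2 , # 1

  neighbours-adjacent : ∀ i → Adj (Path 4 ⊗ Cycle (3 + k)) (# 1 , zero) (neighbours i)
  neighbours-adjacent zero = inj₂ refl , inj₂ last→0
  neighbours-adjacent (suc zero) = inj₂ refl , inj₁ (inj₁ refl)
  neighbours-adjacent (suc (suc zero)) = inj₁ refl , inj₂ last→0
  neighbours-adjacent (suc (suc (suc zero))) = inj₁ refl , inj₁ (inj₁ refl)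

  neighbours-injective : Injective _≡_ _≡_ neighbours
  neighbours-injective {zero} {zero} _ = refl
  neighbours-injective {suc zero} {suc zero} _ = refl
  neighbours-injective {suc (suc zero)} {suc (suc zero)} _ = refl
  neighbours-injective {suc (suc (suc zero))} {suc (suc (suc zero))} _ = refl
  neighbours-injective {zero} {suc zero} ()
  neighbours-injective {zero} {suc (suc zero)} ()
  neighbours-injective {zero} {suc (suc (suc zero))} ()
  neighbours-injective {suc zero} {zero} ()
  neighbours-injective {suc zero} {suc (suc zero)} ()
  neighbours-injective {suc zero} {suc (suc (suc zero))} ()
  neighbours-injective {suc (suc zero)} {zero} ()
  neighbours-injective {suc (suc zero)} {suc zero} ()
  neighbours-injective {suc (suc zero)} {suc (suc (suc zero))} ()
  neighbours-injective {suc (suc (suc zero))} {zero} ()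
  neighbours-injective {suc (suc (suc zero))} {suc zero} ()
  neighbours-injective {suc (suc (suc zero))} {suc (suc zero)} ()

  P₄×C-L11-bound : ∀ {q} → HasL11Labeling (Path 4 ⊗ Cycle (3 + k)) q → 4 ≤ q
  P₄×C-L11-bound = degree⇒L11-bound P₄×C-symmetric neighbours neighbours-adjacent neighbours-injective

GoodCycleOfLength : ℕ → Set
GoodCycleOfLength n = ∃ λ w → length w ≡ n × ∃₂ λ e₁ e₂ → GoodCycle e₁ e₂ w

P₄×C-λ11≡4 : ∀ k → GoodCycleOfLength (3 + k) → λ11≡ (Path 4 ⊗ Cycle (3 + k)) 4
P₄×C-λ11≡4 k (w , len , _ , _ , good) =
  (columnLabeling (at w ∘ toℕ) , cyclicallyGood⇒L11 (goodCycle⇒cyclicallyGood w len 3≤3+k good)) ,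
  λ _ → P₄×C-L11-bound k
  where
  3≤3+k : 3 ≤ 3 + k
  3≤3+k = s≤s (s≤s (s≤s z≤n))

-- Every block ends in the columns S₁ S₂, so blocks concatenate (GoodCycle-++).
S₁ S₂ : Column
S₁ = # 0 ∷ # 0 ∷ # 1 ∷ # 2 ∷ []
S₂ = # 1 ∷ # 3 ∷ # 4 ∷ # 0 ∷ []

cycle9 : List Column
cycle9 =
  (# 3 ∷ # 4 ∷ # 4 ∷ # 0 ∷ []) ∷
  (# 2 ∷ # 1 ∷ # 1 ∷ # 3 ∷ []) ∷
  (# 2 ∷ # 3 ∷ # 0 ∷ # 2 ∷ []) ∷
  (# 0 ∷ # 4 ∷ # 4 ∷ # 2 ∷ []) ∷
  (# 3 ∷ # 1 ∷ # 1 ∷ # 0 ∷ []) ∷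
  (# 3 ∷ # 0 ∷ # 2 ∷ # 3 ∷ []) ∷
  (# 2 ∷ # 4 ∷ # 4 ∷ # 3 ∷ []) ∷
  (# 0 ∷ # 1 ∷ # 1 ∷ # 2 ∷ []) ∷
  (# 0 ∷ # 2 ∷ # 3 ∷ # 0 ∷ []) ∷
  []

block10 : List Column
block10 =
  (# 2 ∷ # 3 ∷ # 4 ∷ # 1 ∷ []) ∷
  (# 0 ∷ # 1 ∷ # 2 ∷ # 2 ∷ []) ∷
  (# 3 ∷ # 4 ∷ # 0 ∷ # 0 ∷ []) ∷
  (# 3 ∷ # 4 ∷ # 1 ∷ # 3 ∷ []) ∷
  (# 1 ∷ # 2 ∷ # 2 ∷ # 3 ∷ []) ∷
  (# 4 ∷ # 0 ∷ # 0 ∷ # 1 ∷ []) ∷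
  (# 4 ∷ # 1 ∷ # 3 ∷ # 4 ∷ []) ∷
  (# 2 ∷ # 2 ∷ # 3 ∷ # 4 ∷ []) ∷
  (# 0 ∷ # 0 ∷ # 1 ∷ # 2 ∷ []) ∷
  (# 1 ∷ # 3 ∷ # 4 ∷ # 0 ∷ []) ∷
  []

block11 : List Column
block11 =
  (# 2 ∷ # 3 ∷ # 4 ∷ # 1 ∷ []) ∷
  (# 0 ∷ # 1 ∷ # 2 ∷ # 2 ∷ []) ∷
  (# 0 ∷ # 4 ∷ # 3 ∷ # 0 ∷ []) ∷
  (# 3 ∷ # 4 ∷ # 1 ∷ # 0 ∷ []) ∷
  (# 2 ∷ # 2 ∷ # 1 ∷ # 3 ∷ []) ∷
  (# 0 ∷ # 3 ∷ # 4 ∷ # 2 ∷ []) ∷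
  (# 4 ∷ # 1 ∷ # 0 ∷ # 0 ∷ []) ∷
  (# 2 ∷ # 1 ∷ # 3 ∷ # 4 ∷ []) ∷
  (# 2 ∷ # 4 ∷ # 3 ∷ # 2 ∷ []) ∷
  (# 0 ∷ # 0 ∷ # 1 ∷ # 2 ∷ []) ∷
  (# 1 ∷ # 3 ∷ # 4 ∷ # 0 ∷ []) ∷
  []

block12 : List Column
block12 =
  (# 2 ∷ # 3 ∷ # 4 ∷ # 1 ∷ []) ∷
  (# 2 ∷ # 1 ∷ # 0 ∷ # 2 ∷ []) ∷
  (# 0 ∷ # 4 ∷ # 3 ∷ # 2 ∷ []) ∷
  (# 1 ∷ # 4 ∷ # 3 ∷ # 0 ∷ []) ∷
  (# 2 ∷ # 0 ∷ # 1 ∷ # 1 ∷ []) ∷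
  (# 2 ∷ # 3 ∷ # 4 ∷ # 2 ∷ []) ∷
  (# 0 ∷ # 3 ∷ # 4 ∷ # 2 ∷ []) ∷
  (# 1 ∷ # 1 ∷ # 0 ∷ # 0 ∷ []) ∷
  (# 2 ∷ # 4 ∷ # 3 ∷ # 1 ∷ []) ∷
  (# 2 ∷ # 4 ∷ # 3 ∷ # 2 ∷ []) ∷
  (# 0 ∷ # 0 ∷ # 1 ∷ # 2 ∷ []) ∷
  (# 1 ∷ # 3 ∷ # 4 ∷ # 0 ∷ []) ∷
  []

block13 : List Column
block13 =
  (# 2 ∷ # 3 ∷ # 4 ∷ # 1 ∷ []) ∷
  (# 0 ∷ # 1 ∷ # 2 ∷ # 2 ∷ []) ∷
  (# 3 ∷ # 4 ∷ # 0 ∷ # 0 ∷ []) ∷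
  (# 1 ∷ # 4 ∷ # 3 ∷ # 3 ∷ []) ∷
  (# 1 ∷ # 2 ∷ # 2 ∷ # 1 ∷ []) ∷
  (# 4 ∷ # 0 ∷ # 0 ∷ # 1 ∷ []) ∷
  (# 3 ∷ # 3 ∷ # 4 ∷ # 4 ∷ []) ∷
  (# 1 ∷ # 2 ∷ # 2 ∷ # 3 ∷ []) ∷
  (# 1 ∷ # 0 ∷ # 0 ∷ # 1 ∷ []) ∷
  (# 4 ∷ # 4 ∷ # 3 ∷ # 1 ∷ []) ∷
  (# 2 ∷ # 2 ∷ # 3 ∷ # 4 ∷ []) ∷
  (# 0 ∷ # 0 ∷ # 1 ∷ # 2 ∷ []) ∷
  (# 1 ∷ # 3 ∷ # 4 ∷ # 0 ∷ []) ∷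
  []

block15 : List Column
block15 =
  (# 4 ∷ # 3 ∷ # 2 ∷ # 1 ∷ []) ∷
  (# 2 ∷ # 1 ∷ # 0 ∷ # 4 ∷ []) ∷
  (# 0 ∷ # 4 ∷ # 3 ∷ # 2 ∷ []) ∷
  (# 3 ∷ # 2 ∷ # 1 ∷ # 0 ∷ []) ∷
  (# 1 ∷ # 0 ∷ # 4 ∷ # 3 ∷ []) ∷
  (# 2 ∷ # 3 ∷ # 4 ∷ # 1 ∷ []) ∷
  (# 0 ∷ # 1 ∷ # 2 ∷ # 2 ∷ []) ∷
  (# 3 ∷ # 4 ∷ # 0 ∷ # 0 ∷ []) ∷
  (# 3 ∷ # 4 ∷ # 1 ∷ # 3 ∷ []) ∷
  (# 1 ∷ # 2 ∷ # 2 ∷ # 3 ∷ []) ∷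
  (# 4 ∷ # 0 ∷ # 0 ∷ # 1 ∷ []) ∷
  (# 4 ∷ # 1 ∷ # 3 ∷ # 4 ∷ []) ∷
  (# 2 ∷ # 2 ∷ # 3 ∷ # 4 ∷ []) ∷
  (# 0 ∷ # 0 ∷ # 1 ∷ # 2 ∷ []) ∷
  (# 1 ∷ # 3 ∷ # 4 ∷ # 0 ∷ []) ∷
  []

block16 : List Column
block16 =
  (# 2 ∷ # 3 ∷ # 4 ∷ # 1 ∷ []) ∷
  (# 0 ∷ # 1 ∷ # 2 ∷ # 2 ∷ []) ∷
  (# 0 ∷ # 4 ∷ # 3 ∷ # 0 ∷ []) ∷
  (# 1 ∷ # 4 ∷ # 3 ∷ # 0 ∷ []) ∷
  (# 1 ∷ # 2 ∷ # 2 ∷ # 1 ∷ []) ∷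
  (# 4 ∷ # 3 ∷ # 0 ∷ # 1 ∷ []) ∷
  (# 0 ∷ # 3 ∷ # 4 ∷ # 4 ∷ []) ∷
  (# 1 ∷ # 2 ∷ # 2 ∷ # 0 ∷ []) ∷
  (# 3 ∷ # 0 ∷ # 1 ∷ # 1 ∷ []) ∷
  (# 3 ∷ # 4 ∷ # 4 ∷ # 3 ∷ []) ∷
  (# 0 ∷ # 2 ∷ # 2 ∷ # 3 ∷ []) ∷
  (# 1 ∷ # 1 ∷ # 0 ∷ # 0 ∷ []) ∷
  (# 4 ∷ # 4 ∷ # 3 ∷ # 1 ∷ []) ∷
  (# 2 ∷ # 2 ∷ # 3 ∷ # 4 ∷ []) ∷
  (# 0 ∷ # 0 ∷ # 1 ∷ # 2 ∷ []) ∷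
  (# 1 ∷ # 3 ∷ # 4 ∷ # 0 ∷ []) ∷
  []

block17 : List Column
block17 =
  (# 2 ∷ # 3 ∷ # 4 ∷ # 1 ∷ []) ∷
  (# 0 ∷ # 1 ∷ # 2 ∷ # 2 ∷ []) ∷
  (# 0 ∷ # 4 ∷ # 3 ∷ # 0 ∷ []) ∷
  (# 1 ∷ # 4 ∷ # 3 ∷ # 0 ∷ []) ∷
  (# 1 ∷ # 2 ∷ # 2 ∷ # 1 ∷ []) ∷
  (# 0 ∷ # 3 ∷ # 4 ∷ # 1 ∷ []) ∷
  (# 4 ∷ # 3 ∷ # 0 ∷ # 0 ∷ []) ∷
  (# 1 ∷ # 2 ∷ # 2 ∷ # 4 ∷ []) ∷
  (# 1 ∷ # 4 ∷ # 3 ∷ # 1 ∷ []) ∷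
  (# 3 ∷ # 0 ∷ # 0 ∷ # 1 ∷ []) ∷
  (# 2 ∷ # 2 ∷ # 4 ∷ # 3 ∷ []) ∷
  (# 1 ∷ # 3 ∷ # 4 ∷ # 2 ∷ []) ∷
  (# 1 ∷ # 0 ∷ # 0 ∷ # 1 ∷ []) ∷
  (# 2 ∷ # 4 ∷ # 3 ∷ # 1 ∷ []) ∷
  (# 2 ∷ # 4 ∷ # 3 ∷ # 2 ∷ []) ∷
  (# 0 ∷ # 0 ∷ # 1 ∷ # 2 ∷ []) ∷
  (# 1 ∷ # 3 ∷ # 4 ∷ # 0 ∷ []) ∷
  []

block18 : List Column
block18 =
  (# 2 ∷ # 3 ∷ # 4 ∷ # 1 ∷ []) ∷
  (# 0 ∷ # 1 ∷ # 2 ∷ # 2 ∷ []) ∷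
  (# 0 ∷ # 4 ∷ # 3 ∷ # 0 ∷ []) ∷
  (# 1 ∷ # 4 ∷ # 3 ∷ # 0 ∷ []) ∷
  (# 1 ∷ # 2 ∷ # 2 ∷ # 1 ∷ []) ∷
  (# 0 ∷ # 3 ∷ # 4 ∷ # 1 ∷ []) ∷
  (# 0 ∷ # 3 ∷ # 4 ∷ # 0 ∷ []) ∷
  (# 2 ∷ # 2 ∷ # 1 ∷ # 0 ∷ []) ∷
  (# 1 ∷ # 4 ∷ # 3 ∷ # 2 ∷ []) ∷
  (# 0 ∷ # 4 ∷ # 3 ∷ # 1 ∷ []) ∷
  (# 2 ∷ # 1 ∷ # 0 ∷ # 0 ∷ []) ∷
  (# 2 ∷ # 3 ∷ # 4 ∷ # 2 ∷ []) ∷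
  (# 1 ∷ # 3 ∷ # 4 ∷ # 2 ∷ []) ∷
  (# 1 ∷ # 0 ∷ # 0 ∷ # 1 ∷ []) ∷
  (# 2 ∷ # 4 ∷ # 3 ∷ # 1 ∷ []) ∷
  (# 2 ∷ # 4 ∷ # 3 ∷ # 2 ∷ []) ∷
  (# 0 ∷ # 0 ∷ # 1 ∷ # 2 ∷ []) ∷
  (# 1 ∷ # 3 ∷ # 4 ∷ # 0 ∷ []) ∷
  []

block19 : List Column
block19 =
  (# 2 ∷ # 3 ∷ # 4 ∷ # 1 ∷ []) ∷
  (# 0 ∷ # 1 ∷ # 2 ∷ # 2 ∷ []) ∷
  (# 0 ∷ # 4 ∷ # 3 ∷ # 0 ∷ []) ∷
  (# 1 ∷ # 4 ∷ # 3 ∷ # 0 ∷ []) ∷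
  (# 1 ∷ # 2 ∷ # 2 ∷ # 1 ∷ []) ∷
  (# 0 ∷ # 3 ∷ # 4 ∷ # 1 ∷ []) ∷
  (# 0 ∷ # 3 ∷ # 4 ∷ # 0 ∷ []) ∷
  (# 1 ∷ # 2 ∷ # 2 ∷ # 0 ∷ []) ∷
  (# 3 ∷ # 4 ∷ # 1 ∷ # 1 ∷ []) ∷
  (# 0 ∷ # 4 ∷ # 3 ∷ # 3 ∷ []) ∷
  (# 0 ∷ # 2 ∷ # 2 ∷ # 0 ∷ []) ∷
  (# 4 ∷ # 1 ∷ # 1 ∷ # 0 ∷ []) ∷
  (# 3 ∷ # 3 ∷ # 4 ∷ # 4 ∷ []) ∷
  (# 0 ∷ # 2 ∷ # 2 ∷ # 3 ∷ []) ∷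
  (# 1 ∷ # 1 ∷ # 0 ∷ # 0 ∷ []) ∷
  (# 4 ∷ # 4 ∷ # 3 ∷ # 1 ∷ []) ∷
  (# 2 ∷ # 2 ∷ # 3 ∷ # 4 ∷ []) ∷
  (# 0 ∷ # 0 ∷ # 1 ∷ # 2 ∷ []) ∷
  (# 1 ∷ # 3 ∷ # 4 ∷ # 0 ∷ []) ∷
  []

BlockCycle : ℕ → Set
BlockCycle n = ∃ λ w → length w ≡ n × GoodCycle S₁ S₂ w

certify : ∀ w → True (goodCycle? S₁ S₂ w) → BlockCycle (length w)
certify w isGood = w , refl , toWitness isGood

BlockCycle-+ : ∀ {m n} → BlockCycle m → BlockCycle n → BlockCycle (m + n)
BlockCycle-+ (u , refl , goodᵤ) (w , refl , goodᵥ) = u ++ w , length-++ u , GoodCycle-++ u w goodᵤ goodᵥ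

pattern 10+_ k = suc (suc (suc (suc (suc (suc (suc (suc (suc (suc k)))))))))

blockCycle : ∀ k → k ≢ 4 → BlockCycle (10 + k)
blockCycle 0 _ = certify block10 _
blockCycle 1 _ = certify block11 _
blockCycle 2 _ = certify block12 _
blockCycle 3 _ = certify block13 _
blockCycle 4 k≢4 = ⊥-elim (k≢4 refl)
blockCycle 5 _ = certify block15 _
blockCycle 6 _ = certify block16 _
blockCycle 7 _ = certify block17 _
blockCycle 8 _ = certify block18 _
blockCycle 9 _ = certify block19 _
blockCycle (10+ k) _ with k ℕ.≟ 4
... | yes refl = BlockCycle-+ (certify block12 _) (certify block12 _)
... | no k≢4 = BlockCycle-+ (certify block10 _) (blockCycle k k≢4)

goodCycleOfLength : ∀ k → 9 + k ≢ 14 → GoodCycleOfLength (9 + k)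
goodCycleOfLength zero _ = cycle9 , refl , T₁ , T₂ , from-yes (goodCycle? T₁ T₂ cycle9)
  where
  T₁ T₂ : Column
  T₁ = # 0 ∷ # 1 ∷ # 1 ∷ # 2 ∷ []
  T₂ = # 0 ∷ # 2 ∷ # 3 ∷ # 0 ∷ []
goodCycleOfLength (suc k) 9+k≢14 with w , len , good ← blockCycle k (9+k≢14 ∘ cong (10 +_)) =
  w , len , S₁ , S₂ , good

mainTheorem16 : (n : ℕ) → 9 ≤ n → n ≢ 14 → λ11≡ (Path 4 ⊗ Cycle n) 4
mainTheorem16 n 9≤n n≢14 with k , refl ← m≤n⇒∃[o]m+o≡n 9≤n =
  P₄×C-λ11≡4 (6 + k) (goodCycleOfLength k n≢14)
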